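{- Let $p$ be a prime number and let $G$ be a connected graph that has a vertex of degree $p$ and has no vertex of degree $kp$ for any integer $k>1$. Then $G$ is prime.
   Context: All graphs are finite, simple and undirected, without isolated vertices. For graphs $H,K$ on the vertex set $V(G)$, $G$ is factored into $H$ and $K$ if $A=BC$, where $A,B,C$ are the adjacency matrices of $G,H,K$ with respect to one common ordering of the vertices. $G$ is prime if in every factorization of $G$ into $H$ and $K$, one of $H$, $K$ is a perfect matching (a $1$-regular spanning graph); a graph with no factorization is prime. -}

module Defs where

open import Data.Nat using (ℕ; zero; suc; _+_; _*_; _<_)
open import Data.Bool using (Bool; true; false)
open import Data.Fin using (Fin; zero; suc)
open import Data.Product using (Σ; ∃; _×_; _,_)
open import Data.Sum using (_⊎_)
open import Relation.Binary.PropositionalEquality using (_≡_; _≢_)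

Σ[<] : (n : ℕ) → (Fin n → ℕ) → ℕ
Σ[<] zero    f = 0
Σ[<] (suc n) f = f zero + Σ[<] n (λ i → f (suc i))

𝟙 : Bool → ℕ
𝟙 true  = 1
𝟙 false = 0

record Graph (n : ℕ) : Set where
  field
    adj        : Fin n → Fin n → Bool
    symmetric  : ∀ i j → adj i j ≡ adj j i
    irreflexive : ∀ i → adj i i ≡ false
    noIsolated : ∀ i → ∃ λ j → adj i j ≡ true
open Graph public

AdjMat : ∀ {n} → Graph n → Fin n → Fin n → ℕ
AdjMat G i j = 𝟙 (adj G i j)

degree : ∀ {n} → Graph n → Fin n → ℕ
degree {n} G v = Σ[<] n (λ j → AdjMat G v j)

data Walk {n : ℕ} (G : Graph n) : Fin n → Fin n → Set where
  here : ∀ {u} → Walk G u u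
  step : ∀ {u v w} → adj G u v ≡ true → Walk G v w → Walk G u w

Connected : ∀ {n} → Graph n → Set
Connected G = ∀ u v → Walk G u v

-- G is factored into H and K : A = B C (matrix product w.r.t. the common ordering Fin n).
FactoredInto : ∀ {n} → Graph n → Graph n → Graph n → Set
FactoredInto {n} G H K =
  ∀ i j → AdjMat G i j ≡ Σ[<] n (λ k → AdjMat H i k * AdjMat K k j)

PerfectMatching : ∀ {n} → Graph n → Set
PerfectMatching H = ∀ v → degree H v ≡ 1

PrimeGraph : ∀ {n} → Graph n → Set
PrimeGraph {n} G =
  (H K : Graph n) → FactoredInto G H K → PerfectMatching H ⊎ PerfectMatching K

module Submission where

-- Writing A = BC for the adjacency matrices of G, H, K, symmetry of A also gives A = CB, so A
-- commutes with C.  For an H-edge ik the sandwich Σⱼ Cₖⱼ ≤ (AC)ᵢₖ = (CA)ᵢₖ ≤ Σₘ Cᵢₘ then shows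
-- that H-neighbours have the same K-degree, hence deg_G = deg_H · deg_K at every vertex.  At the
-- vertex of prime degree p one factor, say H, has degree 1 and K has degree p.  Every H-neighbour
-- then has K-degree p, so its G-degree is a multiple of p and the hypothesis forces its H-degree
-- to be 1: the H-component of that vertex is a single edge.  This property passes along H-edges,
-- and along K-edges because K-neighbours share H-degree and a path u —K— m —H— m′ is a G-edge,
-- which refactors as u —H— u′ —K— m′.  Every G-edge is an H-edge followed by a K-edge, so by
-- connectivity H is a perfect matching.

open import Defs
open import Data.Nat using (ℕ; zero; suc; _+_; _*_; _≤_; _<_; z≤n; z<s)
open import Data.Nat.Properties hiding (_≟_)
open import Data.Nat.Divisibility using (_∣_; m∣m*n)
open import Data.Nat.Primality using (Prime; prime⇒irreducible; prime⇒nonZero)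
open import Algebra.Properties.Semiring.Sum +-*-semiring
  using (sum; sum-cong-≗; ∑-comm; *-distribˡ-sum; *-distribʳ-sum)
open import Data.Bool using (true; false)
open import Data.Fin using (Fin; zero; suc; _≟_)
open import Data.Product using (∃; _×_; _,_; proj₁)
open import Data.Sum as Sum using (_⊎_; inj₁; inj₂)
open import Function using (_∘_)
open import Relation.Binary.PropositionalEquality
open import Relation.Nullary using (yes; no; contradiction)

private variable
  m n p : ℕ

Σ[<]≡sum : ∀ n (f : Fin n → ℕ) → Σ[<] n f ≡ sum f
Σ[<]≡sum zero    f = refl
Σ[<]≡sum (suc n) f = cong (f zero +_) (Σ[<]≡sum n (f ∘ suc))

Σ[<]-cong : ∀ n {f g : Fin n → ℕ} → (∀ i → f i ≡ g i) → Σ[<] n f ≡ Σ[<] n g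
Σ[<]-cong n {f} {g} f≗g = begin
  Σ[<] n f  ≡⟨ Σ[<]≡sum n f ⟩
  sum f     ≡⟨ sum-cong-≗ f≗g ⟩
  sum g     ≡⟨ Σ[<]≡sum n g ⟨
  Σ[<] n g  ∎
  where open ≡-Reasoning

Σ[<]-distribˡ : ∀ n c (f : Fin n → ℕ) → c * Σ[<] n f ≡ Σ[<] n (λ i → c * f i)
Σ[<]-distribˡ n c f = begin
  c * Σ[<] n f            ≡⟨ cong (c *_) (Σ[<]≡sum n f) ⟩
  c * sum f               ≡⟨ *-distribˡ-sum c f ⟩
  sum (λ i → c * f i)     ≡⟨ Σ[<]≡sum n _ ⟨
  Σ[<] n (λ i → c * f i)  ∎
  where open ≡-Reasoning

Σ[<]-distribʳ : ∀ n c (f : Fin n → ℕ) → Σ[<] n f * c ≡ Σ[<] n (λ i → f i * c)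
Σ[<]-distribʳ n c f = begin
  Σ[<] n f * c            ≡⟨ cong (_* c) (Σ[<]≡sum n f) ⟩
  sum f * c               ≡⟨ *-distribʳ-sum c f ⟩
  sum (λ i → f i * c)     ≡⟨ Σ[<]≡sum n _ ⟨
  Σ[<] n (λ i → f i * c)  ∎
  where open ≡-Reasoning

Σ[<]-comm : ∀ m n (f : Fin m → Fin n → ℕ) →
  Σ[<] m (λ i → Σ[<] n (f i)) ≡ Σ[<] n (λ j → Σ[<] m (λ i → f i j))
Σ[<]-comm m n f = begin
  Σ[<] m (λ i → Σ[<] n (f i))            ≡⟨ Σ[<]-cong m (λ i → Σ[<]≡sum n (f i)) ⟩
  Σ[<] m (λ i → sum (f i))               ≡⟨ Σ[<]≡sum m _ ⟩
  sum (λ i → sum (f i))                  ≡⟨ ∑-comm f ⟩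
  sum (λ j → sum (λ i → f i j))          ≡⟨ Σ[<]≡sum n _ ⟨
  Σ[<] n (λ j → sum (λ i → f i j))       ≡⟨ Σ[<]-cong n (λ j → Σ[<]≡sum m _) ⟨
  Σ[<] n (λ j → Σ[<] m (λ i → f i j))    ∎
  where open ≡-Reasoning

Σ[<]-mono-≤ : ∀ n {f g : Fin n → ℕ} → (∀ i → f i ≤ g i) → Σ[<] n f ≤ Σ[<] n g
Σ[<]-mono-≤ zero    f≤g = z≤n
Σ[<]-mono-≤ (suc n) f≤g = +-mono-≤ (f≤g zero) (Σ[<]-mono-≤ n (f≤g ∘ suc))

term≤Σ[<] : ∀ n (f : Fin n → ℕ) i → f i ≤ Σ[<] n f
term≤Σ[<] (suc n) f zero    = m≤m+n (f zero) _
term≤Σ[<] (suc n) f (suc i) = ≤-trans (term≤Σ[<] n (f ∘ suc) i) (m≤n+m _ (f zero))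

two-terms≤Σ[<] : ∀ n (f : Fin n → ℕ) {i j} → i ≢ j → f i + f j ≤ Σ[<] n f
two-terms≤Σ[<] (suc n) f {zero}  {zero}  i≢j = contradiction refl i≢j
two-terms≤Σ[<] (suc n) f {zero}  {suc j} _   = +-monoʳ-≤ (f zero) (term≤Σ[<] n (f ∘ suc) j)
two-terms≤Σ[<] (suc n) f {suc i} {zero}  _   =
  subst (_≤ Σ[<] (suc n) f) (+-comm (f zero) _) (+-monoʳ-≤ (f zero) (term≤Σ[<] n (f ∘ suc) i))
two-terms≤Σ[<] (suc n) f {suc i} {suc j} i≢j =
  ≤-trans (two-terms≤Σ[<] n (f ∘ suc) (i≢j ∘ cong suc)) (m≤n+m _ (f zero))

Σ[<]-positive : ∀ n (f : Fin n → ℕ) → 0 < Σ[<] n f → ∃ λ i → 0 < f i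
Σ[<]-positive (suc n) f pos with f zero in f₀≡
... | suc _ = zero , subst (0 <_) (sym f₀≡) z<s
... | zero  with Σ[<]-positive n (f ∘ suc) pos
...   | i , fᵢ>0 = suc i , fᵢ>0

𝟙≤1 : ∀ b → 𝟙 b ≤ 1
𝟙≤1 true  = ≤-refl
𝟙≤1 false = z≤n

𝟙-positive : ∀ {b} → 0 < 𝟙 b → b ≡ true
𝟙-positive {true} _ = refl

𝟙*𝟙-positive : ∀ a b → 0 < 𝟙 a * 𝟙 b → a ≡ true × b ≡ true
𝟙*𝟙-positive true true _ = refl , refl

Matrix : ℕ → Set
Matrix n = Fin n → Fin n → ℕ

_·_ : Matrix n → Matrix n → Matrix n
_·_ {n} M N i j = Σ[<] n (λ k → M i k * N k j)

·-assoc : (L M N : Matrix n) → ∀ i j → ((L · M) · N) i j ≡ (L · (M · N)) i j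
·-assoc {n} L M N i j = begin
  Σ[<] n (λ k → Σ[<] n (λ l → L i l * M l k) * N k j)
    ≡⟨ Σ[<]-cong n (λ k → Σ[<]-distribʳ n (N k j) _) ⟩
  Σ[<] n (λ k → Σ[<] n (λ l → L i l * M l k * N k j))
    ≡⟨ Σ[<]-comm n n _ ⟩
  Σ[<] n (λ l → Σ[<] n (λ k → L i l * M l k * N k j))
    ≡⟨ Σ[<]-cong n (λ l → Σ[<]-cong n (λ k → *-assoc (L i l) _ _)) ⟩
  Σ[<] n (λ l → Σ[<] n (λ k → L i l * (M l k * N k j)))
    ≡⟨ Σ[<]-cong n (λ l → Σ[<]-distribˡ n (L i l) _) ⟨
  Σ[<] n (λ l → L i l * Σ[<] n (λ k → M l k * N k j))
    ∎
  where open ≡-Reasoning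

rowSum-· : (M N : Matrix n) → ∀ i → Σ[<] n ((M · N) i) ≡ Σ[<] n (λ k → M i k * Σ[<] n (N k))
rowSum-· {n} M N i = begin
  Σ[<] n (λ j → Σ[<] n (λ k → M i k * N k j))  ≡⟨ Σ[<]-comm n n _ ⟩
  Σ[<] n (λ k → Σ[<] n (λ j → M i k * N k j))  ≡⟨ Σ[<]-cong n (λ k → Σ[<]-distribˡ n (M i k) (N k)) ⟨
  Σ[<] n (λ k → M i k * Σ[<] n (N k))          ∎
  where open ≡-Reasoning

degree-positive : (H : Graph n) → ∀ u → 1 ≤ degree H u
degree-positive {n} H u with noIsolated H u
... | w , uw = subst (_≤ degree H u) (cong 𝟙 uw) (term≤Σ[<] n (AdjMat H u) w)

degree≡1⇒unique-neighbour : (H : Graph n) → ∀ {u a b} → degree H u ≡ 1 →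
  adj H u a ≡ true → adj H u b ≡ true → a ≡ b
degree≡1⇒unique-neighbour {n} H {u} {a} {b} deg≡1 ua ub with a ≟ b
... | yes a≡b = a≡b
... | no  a≢b = contradiction 2≤1 1+n≰n
  where
  2≤1 : 2 ≤ 1
  2≤1 = subst₂ _≤_ (cong₂ _+_ (cong 𝟙 ua) (cong 𝟙 ub)) deg≡1
          (two-terms≤Σ[<] n (AdjMat H u) a≢b)

module Factorization (G H K : Graph n) (G≡HK : FactoredInto G H K) where
  private
    A B C : Matrix n
    A = AdjMat G
    B = AdjMat H
    C = AdjMat K

  G≡KH : FactoredInto G K H
  G≡KH i j = begin
    A i j                          ≡⟨ cong 𝟙 (symmetric G i j) ⟩
    A j i                          ≡⟨ G≡HK j i ⟩
    Σ[<] n (λ k → B j k * C k i)   ≡⟨ Σ[<]-cong n (λ k → *-comm (B j k) _) ⟩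
    Σ[<] n (λ k → C k i * B j k)   ≡⟨ Σ[<]-cong n (λ k →
                                        cong₂ (λ a b → 𝟙 a * 𝟙 b) (symmetric K k i) (symmetric H j k)) ⟩
    Σ[<] n (λ k → C i k * B k j)   ∎
    where open ≡-Reasoning

  path⇒edge : ∀ {i k j} → adj H i k ≡ true → adj K k j ≡ true → adj G i j ≡ true
  path⇒edge {i} {k} {j} ik kj = 𝟙-positive (begin-strict
    0                              <⟨ z<s ⟩
    1                              ≡⟨ cong₂ _*_ (cong 𝟙 ik) (cong 𝟙 kj) ⟨
    B i k * C k j                  ≤⟨ term≤Σ[<] n (λ l → B i l * C l j) k ⟩
    Σ[<] n (λ l → B i l * C l j)   ≡⟨ G≡HK i j ⟨
    A i j                          ∎)
    where open ≤-Reasoning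

  edge⇒path : ∀ {i j} → adj G i j ≡ true → ∃ λ k → adj H i k ≡ true × adj K k j ≡ true
  edge⇒path {i} {j} ij with Σ[<]-positive n _ (subst (0 <_) (trans (cong 𝟙 (sym ij)) (G≡HK i j)) z<s)
  ... | k , positive = k , 𝟙*𝟙-positive (adj H i k) (adj K k j) positive

  factor-commutes : ∀ i j → (A · C) i j ≡ (C · A) i j
  factor-commutes i j = begin
    (A · C) i j        ≡⟨ Σ[<]-cong n (λ k → cong (_* C k j) (G≡KH i k)) ⟩
    ((C · B) · C) i j  ≡⟨ ·-assoc C B C i j ⟩
    (C · (B · C)) i j  ≡⟨ Σ[<]-cong n (λ k → cong (C i k *_) (G≡HK k j)) ⟨
    (C · A) i j        ∎
    where open ≡-Reasoning

  H-edge⇒K-degree-≤ : ∀ {i k} → adj H i k ≡ true → degree K k ≤ degree K i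
  H-edge⇒K-degree-≤ {i} {k} ik = begin
    Σ[<] n (C k)   ≤⟨ Σ[<]-mono-≤ n path-bound ⟩
    (A · C) i k    ≡⟨ factor-commutes i k ⟩
    (C · A) i k    ≤⟨ Σ[<]-mono-≤ n (λ m → m*𝟙≤m (C i m) (adj G m k)) ⟩
    Σ[<] n (C i)   ∎
    where
    open ≤-Reasoning

    m*𝟙≤m : ∀ a b → a * 𝟙 b ≤ a
    m*𝟙≤m a b = ≤-trans (*-monoʳ-≤ a (𝟙≤1 b)) (≤-reflexive (*-identityʳ a))

    path-bound : ∀ j → C k j ≤ A i j * C j k
    path-bound j with adj K k j in kj
    ... | false = z≤n
    ... | true  = ≤-reflexive (sym (cong₂ _*_ (cong 𝟙 (path⇒edge ik kj))
                                              (cong 𝟙 (trans (symmetric K j k) kj))))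

  H-edge⇒same-K-degree : ∀ {i k} → adj H i k ≡ true → degree K i ≡ degree K k
  H-edge⇒same-K-degree {i} {k} ik =
    ≤-antisym (H-edge⇒K-degree-≤ (trans (symmetric H k i) ik)) (H-edge⇒K-degree-≤ ik)

  degree-product : ∀ i → degree G i ≡ degree H i * degree K i
  degree-product i = begin
    Σ[<] n (A i)                             ≡⟨ Σ[<]-cong n (G≡HK i) ⟩
    Σ[<] n ((B · C) i)                       ≡⟨ rowSum-· B C i ⟩
    Σ[<] n (λ m → B i m * degree K m)        ≡⟨ Σ[<]-cong n neighbours-share-K-degree ⟩
    Σ[<] n (λ m → B i m * degree K i)        ≡⟨ Σ[<]-distribʳ n (degree K i) (B i) ⟨
    degree H i * degree K i                  ∎
    where
    open ≡-Reasoning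
    neighbours-share-K-degree : ∀ m → B i m * degree K m ≡ B i m * degree K i
    neighbours-share-K-degree m with adj H i m in im
    ... | true  = cong (1 *_) (sym (H-edge⇒same-K-degree im))
    ... | false = refl

OnIsolatedEdge : Graph n → Fin n → Set
OnIsolatedEdge H u = degree H u ≡ 1 × (∀ w → adj H u w ≡ true → degree H w ≡ 1)

OnIsolatedEdge-H-step : (H : Graph n) → ∀ {u w} →
  OnIsolatedEdge H u → adj H u w ≡ true → OnIsolatedEdge H w
OnIsolatedEdge-H-step H {u} {w} (deg-u≡1 , deg-nbr≡1) uw = deg-nbr≡1 w uw , deg-w-nbr≡1
  where
  deg-w-nbr≡1 : ∀ w′ → adj H w w′ ≡ true → degree H w′ ≡ 1
  deg-w-nbr≡1 w′ ww′ =
    subst (λ x → degree H x ≡ 1)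
          (degree≡1⇒unique-neighbour H (deg-nbr≡1 w uw) (trans (symmetric H w u) uw) ww′) deg-u≡1

module Propagation (G H K : Graph n) (G≡HK : FactoredInto G H K) where
  open Factorization G H K G≡HK using (G≡KH; edge⇒path)
  open Factorization G K H G≡KH using () renaming
    (H-edge⇒same-K-degree to K-edge⇒same-H-degree; path⇒edge to K-H-path⇒edge)

  OnIsolatedEdge-K-step : ∀ {u m} → OnIsolatedEdge H u → adj K u m ≡ true → OnIsolatedEdge H m
  OnIsolatedEdge-K-step {u} {m} (deg-u≡1 , deg-nbr≡1) um =
    trans (sym (K-edge⇒same-H-degree um)) deg-u≡1 , deg-m-nbr≡1
    where
    deg-m-nbr≡1 : ∀ m′ → adj H m m′ ≡ true → degree H m′ ≡ 1
    deg-m-nbr≡1 m′ mm′ with edge⇒path (K-H-path⇒edge um mm′)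
    ... | u′ , uu′ , u′m′ = trans (sym (K-edge⇒same-H-degree u′m′)) (deg-nbr≡1 u′ uu′)

  OnIsolatedEdge-G-step : ∀ {u v} → OnIsolatedEdge H u → adj G u v ≡ true → OnIsolatedEdge H v
  OnIsolatedEdge-G-step u-iso uv with edge⇒path uv
  ... | k , uk , kv = OnIsolatedEdge-K-step (OnIsolatedEdge-H-step H u-iso uk) kv

  OnIsolatedEdge-walk : ∀ {u v} → Walk G u v → OnIsolatedEdge H u → OnIsolatedEdge H v
  OnIsolatedEdge-walk here          u-iso = u-iso
  OnIsolatedEdge-walk (step uv walk) u-iso = OnIsolatedEdge-walk walk (OnIsolatedEdge-G-step u-iso uv)

m*n≡p⇒m≡1⊎n≡1 : Prime p → m * n ≡ p → m ≡ 1 ⊎ n ≡ 1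
m*n≡p⇒m≡1⊎n≡1 {p} {m} {n} p-prime mn≡p
  with prime⇒irreducible p-prime (subst (m ∣_) mn≡p (m∣m*n n))
... | inj₁ m≡1 = inj₁ m≡1
... | inj₂ m≡p = inj₂ (*-cancelˡ-≡ n 1 p {{prime⇒nonZero p-prime}} (begin
  p * n  ≡⟨ cong (_* n) m≡p ⟨
  m * n  ≡⟨ mn≡p ⟩
  p      ≡⟨ *-identityʳ p ⟨
  p * 1  ∎))
  where open ≡-Reasoning

factor-of-degree-one-is-perfect-matching : (G H K : Graph n) → FactoredInto G H K → Connected G →
  (∀ (k : ℕ) v → 1 < k → degree G v ≢ k * p) →
  ∀ {v} → degree G v ≡ p → degree H v ≡ 1 → PerfectMatching H
factor-of-degree-one-is-perfect-matching {p = p} G H K G≡HK connected no-proper-multiple {v}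
  deg-G-v≡p deg-H-v≡1 u =
  proj₁ (OnIsolatedEdge-walk (connected v u) (deg-H-v≡1 , deg-nbr≡1))
  where
  open Factorization G H K G≡HK using (degree-product; H-edge⇒same-K-degree)
  open Propagation G H K G≡HK using (OnIsolatedEdge-walk)

  deg-K-v≡p : degree K v ≡ p
  deg-K-v≡p = begin
    degree K v               ≡⟨ *-identityˡ (degree K v) ⟨
    1 * degree K v           ≡⟨ cong (_* degree K v) deg-H-v≡1 ⟨
    degree H v * degree K v  ≡⟨ degree-product v ⟨
    degree G v               ≡⟨ deg-G-v≡p ⟩
    p                        ∎
    where open ≡-Reasoning

  deg-nbr≡1 : ∀ w → adj H v w ≡ true → degree H w ≡ 1
  deg-nbr≡1 w vw = ≤-antisym (≮⇒≥ λ 1<deg → no-proper-multiple (degree H w) w 1<deg deg-G-w≡deg-H-w*p)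
                             (degree-positive H w)
    where
    deg-G-w≡deg-H-w*p : degree G w ≡ degree H w * p
    deg-G-w≡deg-H-w*p = trans (degree-product w)
      (cong (degree H w *_) (trans (sym (H-edge⇒same-K-degree vw)) deg-K-v≡p))

mainTheorem14 : (p : ℕ) → Prime p → (n : ℕ) → (G : Graph n) → Connected G →
    (∃ λ v → degree G v ≡ p) →
    (∀ (k : ℕ) v → 1 < k → degree G v ≢ k * p) →
    PrimeGraph G
mainTheorem14 p p-prime n G connected (v , deg-v≡p) no-proper-multiple H K G≡HK =
  Sum.map (matching H K G≡HK) (matching K H G≡KH)
          (m*n≡p⇒m≡1⊎n≡1 p-prime (trans (sym (degree-product v)) deg-v≡p))
  where
  open Factorization G H K G≡HK using (G≡KH; degree-product)

  matching : (H′ K′ : Graph n) → FactoredInto G H′ K′ → degree H′ v ≡ 1 → PerfectMatching H′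
  matching H′ K′ G≡H′K′ =
    factor-of-degree-one-is-perfect-matching G H′ K′ G≡H′K′ connected no-proper-multiple deg-v≡p
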